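{- Let $\mathbf{o}=(0,0)$ and let $\mathbf{p}=(a,b)\in\mathbb{Z}^2$ be such that $\overline{\mathbf{o}\mathbf{p}}$ is a prime segment and $\mathbf{p}\notin\{(\pm1,0),(0,\pm1)\}$. Then there exists $\mathbf{q}\in\mathbb{Z}^2$ such that, with $\mathbf{r}:=\mathbf{p}-\mathbf{q}$, the triangles $\triangle\mathbf{o}\mathbf{p}\mathbf{q}$ and $\triangle\mathbf{o}\mathbf{p}\mathbf{r}$ are minimum triangles, the segments $\overline{\mathbf{o}\mathbf{q}}$ and $\overline{\mathbf{o}\mathbf{r}}$ are prime and strictly shorter than $\overline{\mathbf{o}\mathbf{p}}$, and $$\overline{\mathbf{o}\mathbf{p}}=\triangle\mathbf{o}\mathbf{p}\mathbf{q}+\triangle\mathbf{o}\mathbf{p}\mathbf{r}-\overline{\mathbf{o}\mathbf{q}}-\overline{\mathbf{o}\mathbf{r}},$$ i.e. $\overline{\mathbf{o}\mathbf{p}}+\overline{\mathbf{o}\mathbf{q}}+\overline{\mathbf{o}\mathbf{r}}=\triangle\mathbf{o}\mathbf{p}\mathbf{q}+\triangle\mathbf{o}\mathbf{p}\mathbf{r}$.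
   Context: Sums of sets are Minkowski sums; subtraction is the Minkowski difference ($C=A-B$ means $C+B=A$). $\overline{\mathbf{a}\mathbf{b}}=\mathrm{conv}\{\mathbf{a},\mathbf{b}\}$, $\triangle\mathbf{a}\mathbf{b}\mathbf{c}=\mathrm{conv}\{\mathbf{a},\mathbf{b},\mathbf{c}\}$. For distinct $\mathbf{p},\mathbf{q}\in\mathbb{Z}^2$, $\overline{\mathbf{p}\mathbf{q}}$ is prime if it contains no integral points other than its endpoints. A minimum triangle is a triangle with vertices in $\mathbb{Z}^2$ and area exactly $1/2$.
   Formalization: The segments, triangles and their Minkowski sums are taken as subsets of the rational plane ℚ². -}

module Defs where

open import Data.Integer as ℤ using (ℤ; +_; -[1+_])
open import Data.Rational as ℚ using (ℚ; _/_; 0ℚ; 1ℚ)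
open import Data.Product using (Σ; ∃; _×_; _,_; proj₁; proj₂)
open import Data.Sum using (_⊎_)
open import Relation.Binary.PropositionalEquality using (_≡_)
open import Relation.Nullary using (¬_)

Pt : Set
Pt = ℤ × ℤ

Pℚ : Set
Pℚ = ℚ × ℚ

infixl 6 _-ᵖ_
_-ᵖ_ : Pt → Pt → Pt
(a , b) -ᵖ (c , d) = (a ℤ.- c , b ℤ.- d)

embℤ : ℤ → ℚ
embℤ z = z / 1

emb : Pt → Pℚ
emb (a , b) = (embℤ a , embℤ b)

_+ᵠ_ : Pℚ → Pℚ → Pℚ
(a , b) +ᵠ (c , d) = (a ℚ.+ c , b ℚ.+ d)

_·_ : ℚ → Pℚ → Pℚ
t · (a , b) = (t ℚ.* a , t ℚ.* b)

Region : Set₁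
Region = Pℚ → Set

seg : Pt → Pt → Region
seg a b x = Σ ℚ λ s → Σ ℚ λ t →
  (0ℚ ℚ.≤ s) × (0ℚ ℚ.≤ t) × (s ℚ.+ t ≡ 1ℚ) ×
  (x ≡ (s · emb a) +ᵠ (t · emb b))

tri : Pt → Pt → Pt → Region
tri a b c x = Σ ℚ λ r → Σ ℚ λ s → Σ ℚ λ t →
  (0ℚ ℚ.≤ r) × (0ℚ ℚ.≤ s) × (0ℚ ℚ.≤ t) × (r ℚ.+ s ℚ.+ t ≡ 1ℚ) ×
  (x ≡ ((r · emb a) +ᵠ (s · emb b)) +ᵠ (t · emb c))

infixl 6 _⊕_
_⊕_ : Region → Region → Region
(A ⊕ B) x = Σ Pℚ λ a → Σ Pℚ λ b → A a × B b × (x ≡ a +ᵠ b)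

infix 4 _≐_
_≐_ : Region → Region → Set
A ≐ B = ∀ x → (A x → B x) × (B x → A x)

PrimeSeg : Pt → Pt → Set
PrimeSeg p q = ¬ (p ≡ q) × (∀ (z : Pt) → seg p q (emb z) → (z ≡ p) ⊎ (z ≡ q))

-- twice the signed area of the triangle a b c
det2 : Pt → Pt → Pt → ℤ
det2 (a₁ , a₂) (b₁ , b₂) (c₁ , c₂) =
  (b₁ ℤ.- a₁) ℤ.* (c₂ ℤ.- a₂) ℤ.- (b₂ ℤ.- a₂) ℤ.* (c₁ ℤ.- a₁)

-- Minimum triangle: lattice triangle of area exactly 1/2, i.e. |det| = 1
MinTri : Pt → Pt → Pt → Set
MinTri a b c = ℤ.∣ det2 a b c ∣ ≡ 1

len² : Pt → Pt → ℤ
len² (a₁ , a₂) (b₁ , b₂) =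
  (b₁ ℤ.- a₁) ℤ.* (b₁ ℤ.- a₁) ℤ.+ (b₂ ℤ.- a₂) ℤ.* (b₂ ℤ.- a₂)

o : Pt
o = (+ 0 , + 0)

-- Since o p is prime, gcd (a , b) = 1 and Bézout gives q₀ ∈ ℤ² with det (p , q₀) = 1. Subtracting a
-- multiple of p from q₀ keeps the determinant and brings r = ⟨p , q⟩ into [0 , ‖p‖²). Then o p q and
-- o p (p − q) are minimum triangles, so their edges o q and o (p − q) are prime (a lattice point t w on
-- such an edge has det (p , t w) = ± t, hence t ∈ {0 , 1}), and Lagrange's identity
-- ‖w‖² ‖p‖² = ⟨p , w⟩² + det (p , w)² = ⟨p , w⟩² + 1, with ⟨p , w⟩ = r resp. ‖p‖² − r, gives
-- ‖w‖² < ‖p‖²; here r ≠ 0 since ‖p‖² ≥ 2. The Minkowski identity holds for all P, Q ∈ ℚ²: a point of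
-- [0,P] + [0,Q] + [0,P−Q] is regrouped according to which of the Q- and (P−Q)-coefficients is larger,
-- and conversely any excess of P-coefficient beyond 1 is split along P = Q + (P − Q).
module Submission where

open import Defs
open import Level using (0ℓ)
open import Data.Empty using (⊥-elim)
open import Data.Nat as ℕ using (ℕ; zero; suc; z≤n; s≤s)
import Data.Nat.Properties as ℕP
open import Data.Nat.Tactic.RingSolver as ℕ-Solver using ()
open import Data.Nat.GCD using (module Bézout)
import Data.Nat.Divisibility as ℕDiv
import Data.Nat.Coprimality as ℕCoprime
open import Data.Integer as ℤ using (ℤ; +_; -[1+_])
import Data.Integer.Properties as ℤP
open import Data.Integer.Tactic.RingSolver as ℤ-Solver using ()
open import Data.Integer.Coprimality using (Coprime)
open import Data.Integer.Divisibility.Signed using (divides; ∣ᵤ⇒∣)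
open import Data.Integer.DivMod using (a≡a%ℕn+[a/ℕn]*n; n%ℕd<d)
import Data.Rational as ℚ
open ℚ using (0ℚ; 1ℚ)
import Data.Rational.Properties as ℚP
open import Data.Product using (Σ; _×_; _,_; proj₁; proj₂)
open import Data.Sum as Sum using (_⊎_; inj₁; inj₂)
open import Relation.Binary.PropositionalEquality
open import Relation.Nullary using (¬_)
open import Relation.Nullary.Decidable using (dec⇒maybe)
open import Tactic.RingSolver using (solve-∀)
open import Tactic.RingSolver.Core.AlmostCommutativeRing
  using (AlmostCommutativeRing; fromCommutativeRing)

ℚ-ring : AlmostCommutativeRing 0ℓ 0ℓ
ℚ-ring = fromCommutativeRing ℚP.+-*-commutativeRing (λ x → dec⇒maybe (0ℚ ℚP.≟ x))

module Vectors where
  open import Data.Integer using (_+_; _-_; _*_; ∣_∣)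

  det : Pt → Pt → ℤ
  det (a , b) (c , d) = a * d - b * c

  dot : Pt → Pt → ℤ
  dot (a , b) (c , d) = a * c + b * d

  infixr 7 _•_
  _•_ : ℤ → Pt → Pt
  k • (a , b) = (k * a , k * b)

  ‖_‖² : Pt → ℕ
  ‖ (a , b) ‖² = ∣ a ∣ ℕ.* ∣ a ∣ ℕ.+ ∣ b ∣ ℕ.* ∣ b ∣

open Vectors

module Plane where
  open import Data.Rational using (ℚ; _+_; _-_; _*_; -_; _≤_)

  0ᵠ : Pℚ
  0ᵠ = (0ℚ , 0ℚ)

  infixl 6 _-ᵠ_
  _-ᵠ_ : Pℚ → Pℚ → Pℚ
  (a , b) -ᵠ (c , d) = (a - c , b - d)

  detℚ : Pℚ → Pℚ → ℚ
  detℚ (a , b) (c , d) = a * d - b * c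

  segℚ : Pℚ → Pℚ → Region
  segℚ a b x = Σ ℚ λ s → Σ ℚ λ t →
    (0ℚ ≤ s) × (0ℚ ≤ t) × (s + t ≡ 1ℚ) ×
    (x ≡ (s · a) +ᵠ (t · b))

  triℚ : Pℚ → Pℚ → Pℚ → Region
  triℚ a b c x = Σ ℚ λ r → Σ ℚ λ s → Σ ℚ λ t →
    (0ℚ ≤ r) × (0ℚ ≤ s) × (0ℚ ≤ t) × (r + s + t ≡ 1ℚ) ×
    (x ≡ ((r · a) +ᵠ (s · b)) +ᵠ (t · c))

  detℚ-scale : ∀ P s t W → detℚ P ((s · 0ᵠ) +ᵠ (t · W)) ≡ t * detℚ P W
  detℚ-scale (a , b) s t (c , d) = lemma a b s t c d
    where
    lemma : ∀ a b s t c d → a * (s * 0ℚ + t * d) - b * (s * 0ℚ + t * c) ≡ t * (a * d - b * c)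
    lemma = solve-∀ ℚ-ring

  p≤q⇒0≤q-p : ∀ {p q} → p ≤ q → 0ℚ ≤ q - p
  p≤q⇒0≤q-p {p} {q} p≤q = subst (_≤ q - p) (ℚP.+-inverseʳ p) (ℚP.+-monoˡ-≤ (- p) p≤q)

  0≤+ : ∀ {p q} → 0ℚ ≤ p → 0ℚ ≤ q → 0ℚ ≤ p + q
  0≤+ = ℚP.+-mono-≤

  s+t≡1⇒t≤1 : ∀ {s t} → 0ℚ ≤ s → s + t ≡ 1ℚ → t ≤ 1ℚ
  s+t≡1⇒t≤1 {s} {t} 0≤s s+t≡1 = subst₂ _≤_ (ℚP.+-identityˡ t) s+t≡1 (ℚP.+-monoˡ-≤ t 0≤s)

  a+c+[b-c]≡a+b : ∀ a b c → a + c + (b - c) ≡ a + b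
  a+c+[b-c]≡a+b = solve-∀ ℚ-ring

  1-p+p≡1 : ∀ p → 1ℚ - p + p ≡ 1ℚ
  1-p+p≡1 = solve-∀ ℚ-ring

  segℚ⊕segℚ⊕segℚ⊆triℚ⊕triℚ : ∀ P Q x →
    (segℚ 0ᵠ P ⊕ segℚ 0ᵠ Q ⊕ segℚ 0ᵠ (P -ᵠ Q)) x → (triℚ 0ᵠ P Q ⊕ triℚ 0ᵠ P (P -ᵠ Q)) x
  segℚ⊕segℚ⊕segℚ⊆triℚ⊕triℚ (P₁ , P₂) (Q₁ , Q₂) _
    (_ , _ , (_ , _ , (s₀ , s , 0≤s₀ , 0≤s , ∑s , refl) , (t₀ , t , 0≤t₀ , 0≤t , ∑t , refl) , refl)
         , (u₀ , u , 0≤u₀ , 0≤u , ∑u , refl) , refl)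
    with ℚP.≤-total t u
  ... | inj₁ t≤u =
    _ , _ , (s₀ , s , 0ℚ , 0≤s₀ , 0≤s , ℚP.≤-refl , trans (ℚP.+-identityʳ _) ∑s , refl)
          , (u₀ , t , u - t , 0≤u₀ , 0≤t , p≤q⇒0≤q-p t≤u , trans (a+c+[b-c]≡a+b u₀ u t) ∑u , refl)
          , cong₂ _,_ (regroup s₀ s t₀ t u₀ u P₁ Q₁) (regroup s₀ s t₀ t u₀ u P₂ Q₂)
    where
    regroup : ∀ s₀ s t₀ t u₀ u P Q →
      s₀ * 0ℚ + s * P + (t₀ * 0ℚ + t * Q) + (u₀ * 0ℚ + u * (P - Q)) ≡
      (s₀ * 0ℚ + s * P + 0ℚ * Q) + (u₀ * 0ℚ + t * P + (u - t) * (P - Q))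
    regroup = solve-∀ ℚ-ring
  ... | inj₂ u≤t =
    _ , _ , (t₀ , u , t - u , 0≤t₀ , 0≤u , p≤q⇒0≤q-p u≤t , trans (a+c+[b-c]≡a+b t₀ t u) ∑t , refl)
          , (s₀ , s , 0ℚ , 0≤s₀ , 0≤s , ℚP.≤-refl , trans (ℚP.+-identityʳ _) ∑s , refl)
          , cong₂ _,_ (regroup s₀ s t₀ t u₀ u P₁ Q₁) (regroup s₀ s t₀ t u₀ u P₂ Q₂)
    where
    regroup : ∀ s₀ s t₀ t u₀ u P Q →
      s₀ * 0ℚ + s * P + (t₀ * 0ℚ + t * Q) + (u₀ * 0ℚ + u * (P - Q)) ≡
      (t₀ * 0ℚ + u * P + (t - u) * Q) + (s₀ * 0ℚ + s * P + 0ℚ * (P - Q))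
    regroup = solve-∀ ℚ-ring

  triℚ⊕triℚ⊆segℚ⊕segℚ⊕segℚ : ∀ P Q x →
    (triℚ 0ᵠ P Q ⊕ triℚ 0ᵠ P (P -ᵠ Q)) x → (segℚ 0ᵠ P ⊕ segℚ 0ᵠ Q ⊕ segℚ 0ᵠ (P -ᵠ Q)) x
  triℚ⊕triℚ⊆segℚ⊕segℚ⊕segℚ (P₁ , P₂) (Q₁ , Q₂) _
    (_ , _ , (r₀ , r , s , 0≤r₀ , 0≤r , 0≤s , ∑₁ , refl) , (r₀′ , r′ , s′ , 0≤r₀′ , 0≤r′ , 0≤s′ , ∑₂ , refl) , refl)
    with ℚP.≤-total (r + r′) 1ℚ
  ... | inj₁ r+r′≤1 =
    _ , _ , (_ , _ , (1ℚ - (r + r′) , r + r′ , p≤q⇒0≤q-p r+r′≤1 , 0≤+ 0≤r 0≤r′ , 1-p+p≡1 (r + r′) , refl)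
                   , (r₀ + r , s , 0≤+ 0≤r₀ 0≤r , 0≤s , ∑₁ , refl) , refl)
          , (r₀′ + r′ , s′ , 0≤+ 0≤r₀′ 0≤r′ , 0≤s′ , ∑₂ , refl)
          , cong₂ _,_ (regroup r₀ r s r₀′ r′ s′ P₁ Q₁) (regroup r₀ r s r₀′ r′ s′ P₂ Q₂)
    where
    regroup : ∀ r₀ r s r₀′ r′ s′ P Q →
      r₀ * 0ℚ + r * P + s * Q + (r₀′ * 0ℚ + r′ * P + s′ * (P - Q)) ≡
      (1ℚ - (r + r′)) * 0ℚ + (r + r′) * P + ((r₀ + r) * 0ℚ + s * Q) + ((r₀′ + r′) * 0ℚ + s′ * (P - Q))
    regroup = solve-∀ ℚ-ring
  ... | inj₂ 1≤r+r′ =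
    _ , _ , (_ , _ , (0ℚ , 1ℚ , ℚP.≤-refl , ℚP.nonNegative⁻¹ 1ℚ , refl , refl)
                   , (r₀ + r₀′ + s′ , s + e , 0≤+ (0≤+ 0≤r₀ 0≤r₀′) 0≤s′ , 0≤+ 0≤s 0≤e
                     , trans (sum r₀ r s r₀′ r′ s′) (cong₂ (λ x y → x + y - 1ℚ) ∑₁ ∑₂) , refl) , refl)
          , (r₀′ + r₀ + s , s′ + e , 0≤+ (0≤+ 0≤r₀′ 0≤r₀) 0≤s , 0≤+ 0≤s′ 0≤e
            , trans (sum′ r₀ r s r₀′ r′ s′) (cong₂ (λ x y → x + y - 1ℚ) ∑₁ ∑₂) , refl)
          , cong₂ _,_ (regroup r₀ r s r₀′ r′ s′ P₁ Q₁) (regroup r₀ r s r₀′ r′ s′ P₂ Q₂)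
    where
    e = r + r′ - 1ℚ
    0≤e : 0ℚ ≤ e
    0≤e = p≤q⇒0≤q-p 1≤r+r′
    sum : ∀ r₀ r s r₀′ r′ s′ → r₀ + r₀′ + s′ + (s + (r + r′ - 1ℚ)) ≡ r₀ + r + s + (r₀′ + r′ + s′) - 1ℚ
    sum = solve-∀ ℚ-ring
    sum′ : ∀ r₀ r s r₀′ r′ s′ → r₀′ + r₀ + s + (s′ + (r + r′ - 1ℚ)) ≡ r₀ + r + s + (r₀′ + r′ + s′) - 1ℚ
    sum′ = solve-∀ ℚ-ring
    regroup : ∀ r₀ r s r₀′ r′ s′ P Q →
      r₀ * 0ℚ + r * P + s * Q + (r₀′ * 0ℚ + r′ * P + s′ * (P - Q)) ≡
      0ℚ * 0ℚ + 1ℚ * P + ((r₀ + r₀′ + s′) * 0ℚ + (s + (r + r′ - 1ℚ)) * Q)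
        + ((r₀′ + r₀ + s) * 0ℚ + (s′ + (r + r′ - 1ℚ)) * (P - Q))
    regroup = solve-∀ ℚ-ring

  segℚ⊕segℚ⊕segℚ≐triℚ⊕triℚ : ∀ P Q →
    segℚ 0ᵠ P ⊕ segℚ 0ᵠ Q ⊕ segℚ 0ᵠ (P -ᵠ Q) ≐ triℚ 0ᵠ P Q ⊕ triℚ 0ᵠ P (P -ᵠ Q)
  segℚ⊕segℚ⊕segℚ≐triℚ⊕triℚ P Q x = segℚ⊕segℚ⊕segℚ⊆triℚ⊕triℚ P Q x , triℚ⊕triℚ⊆segℚ⊕segℚ⊕segℚ P Q x

module Embedding where
  open import Data.Rational using (mkℚ; ↥_; *≤*; 1/_; _+_; _-_; _*_; -_; _≤_)
  open Plane using (0ᵠ; _-ᵠ_; detℚ; p≤q⇒0≤q-p; 1-p+p≡1)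

  -- z / 1 only normalises for closed z; mkℚ z 0 _ is its normal form, on which ℚ.+ and ℚ.* compute.
  embℤ≡mkℚ : ∀ z → embℤ z ≡ mkℚ z 0 (ℕCoprime.sym (ℕCoprime.1-coprimeTo ℤ.∣ z ∣))
  embℤ≡mkℚ z = ℚP.↥p/↧p≡p _

  embℤ-+ : ∀ x y → embℤ (x ℤ.+ y) ≡ embℤ x + embℤ y
  embℤ-+ x y = trans (cong embℤ (x+y≡x*1+y*1 x y)) (sym (cong₂ _+_ (embℤ≡mkℚ x) (embℤ≡mkℚ y)))
    where
    x+y≡x*1+y*1 : ∀ x y → x ℤ.+ y ≡ x ℤ.* + 1 ℤ.+ y ℤ.* + 1
    x+y≡x*1+y*1 = ℤ-Solver.solve-∀

  embℤ-* : ∀ x y → embℤ (x ℤ.* y) ≡ embℤ x * embℤ y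
  embℤ-* x y = sym (cong₂ _*_ (embℤ≡mkℚ x) (embℤ≡mkℚ y))

  embℤ-neg : ∀ x → embℤ (ℤ.- x) ≡ - embℤ x
  embℤ-neg x = begin
    embℤ (ℤ.- x)          ≡⟨ cong embℤ (ℤP.-1*i≡-i x) ⟨
    embℤ (ℤ.- + 1 ℤ.* x)  ≡⟨ embℤ-* (ℤ.- + 1) x ⟩
    - 1ℚ * embℤ x         ≡⟨ -1*q≡-q (embℤ x) ⟩
    - embℤ x              ∎
    where
    open ≡-Reasoning
    -1*q≡-q : ∀ q → - 1ℚ * q ≡ - q
    -1*q≡-q = solve-∀ ℚ-ring

  embℤ-sub : ∀ x y → embℤ (x ℤ.- y) ≡ embℤ x - embℤ y
  embℤ-sub x y = trans (embℤ-+ x (ℤ.- y)) (cong (λ q → embℤ x + q) (embℤ-neg y))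

  embℤ-injective : ∀ {x y} → embℤ x ≡ embℤ y → x ≡ y
  embℤ-injective {x} {y} eq = cong ↥_ (trans (sym (embℤ≡mkℚ x)) (trans eq (embℤ≡mkℚ y)))

  embℤ-cancel-≤ : ∀ {x y} → embℤ x ≤ embℤ y → x ℤ.≤ y
  embℤ-cancel-≤ {x} {y} x≤y with subst₂ _≤_ (embℤ≡mkℚ x) (embℤ≡mkℚ y) x≤y
  ... | *≤* x*1≤y*1 = subst₂ ℤ._≤_ (ℤP.*-identityʳ x) (ℤP.*-identityʳ y) x*1≤y*1

  integral-0≤t≤1⇒t≡0∨1 : ∀ i {t} → embℤ i ≡ t → 0ℚ ≤ t → t ≤ 1ℚ → t ≡ 0ℚ ⊎ t ≡ 1ℚ
  integral-0≤t≤1⇒t≡0∨1 i refl 0≤t t≤1 = cases i (embℤ-cancel-≤ 0≤t) (embℤ-cancel-≤ t≤1)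
    where
    cases : ∀ i → + 0 ℤ.≤ i → i ℤ.≤ + 1 → embℤ i ≡ 0ℚ ⊎ embℤ i ≡ 1ℚ
    cases (+ 0) _ _ = inj₁ refl
    cases (+ 1) _ _ = inj₂ refl
    cases (+ suc (suc _)) _ (ℤ.+≤+ (s≤s ()))

  emb-sub : ∀ p q → emb (p -ᵖ q) ≡ emb p -ᵠ emb q
  emb-sub (a , b) (c , d) = cong₂ _,_ (embℤ-sub a c) (embℤ-sub b d)

  emb-det : ∀ p w → embℤ (det p w) ≡ detℚ (emb p) (emb w)
  emb-det (a , b) (c , d) = trans (embℤ-sub (a ℤ.* d) (b ℤ.* c)) (cong₂ _-_ (embℤ-* a d) (embℤ-* b c))

  ∈seg-o-multiple : ∀ k w → seg o (+ suc k • w) (emb w)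
  ∈seg-o-multiple k (a , b) =
    1ℚ - t , t , p≤q⇒0≤q-p t≤1 , 0≤t , 1-p+p≡1 t , cong₂ _,_ (coordinate a) (coordinate b)
    where
    open ≡-Reasoning
    g = mkℚ (+ suc k) 0 (ℕCoprime.sym (ℕCoprime.1-coprimeTo (suc k)))
    t = 1/ g
    0≤t : 0ℚ ≤ t
    0≤t = *≤* (ℤ.+≤+ z≤n)
    t≤1 : t ≤ 1ℚ
    t≤1 = *≤* (ℤ.+≤+ (s≤s z≤n))
    regroup : ∀ t g x → (1ℚ - t) * 0ℚ + t * (g * x) ≡ (t * g) * x
    regroup = solve-∀ ℚ-ring
    coordinate : ∀ x → embℤ x ≡ (1ℚ - t) * 0ℚ + t * embℤ (+ suc k ℤ.* x)
    coordinate x = sym (begin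
      (1ℚ - t) * 0ℚ + t * embℤ (+ suc k ℤ.* x) ≡⟨ cong (λ y → (1ℚ - t) * 0ℚ + t * y) (embℤ-* (+ suc k) x) ⟩
      (1ℚ - t) * 0ℚ + t * (embℤ (+ suc k) * embℤ x)
        ≡⟨ cong (λ y → (1ℚ - t) * 0ℚ + t * (y * embℤ x)) (embℤ≡mkℚ (+ suc k)) ⟩
      (1ℚ - t) * 0ℚ + t * (g * embℤ x)          ≡⟨ regroup t g (embℤ x) ⟩
      (t * g) * embℤ x                           ≡⟨ cong (_* embℤ x) (ℚP.*-inverseˡ g) ⟩
      1ℚ * embℤ x                                ≡⟨ ℚP.*-identityˡ (embℤ x) ⟩
      embℤ x                                     ∎)

  on-ray : ∀ {z w s t k} → emb z ≡ (s · 0ᵠ) +ᵠ (t · emb w) → embℤ k ≡ t → z ≡ k • w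
  on-ray {z₁ , z₂} {w₁ , w₂} {s} {k = k} z≡tw refl =
    cong₂ _,_ (coordinate (cong proj₁ z≡tw)) (coordinate (cong proj₂ z≡tw))
    where
    s*0+q≡q : ∀ s q → s * 0ℚ + q ≡ q
    s*0+q≡q = solve-∀ ℚ-ring
    coordinate : ∀ {x y} → embℤ x ≡ s * 0ℚ + embℤ k * embℤ y → x ≡ k ℤ.* y
    coordinate {x} {y} eq = embℤ-injective (trans eq (trans (s*0+q≡q s _) (sym (embℤ-* k y))))

open Plane
open Embedding
open import Data.Integer using (_+_; _-_; _*_; -_; ∣_∣; _<_)

seg⊕seg⊕seg≐tri⊕tri : ∀ p q → seg o p ⊕ seg o q ⊕ seg o (p -ᵖ q) ≐ tri o p q ⊕ tri o p (p -ᵖ q)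
seg⊕seg⊕seg≐tri⊕tri p q =
  subst (λ R → segℚ 0ᵠ (emb p) ⊕ segℚ 0ᵠ (emb q) ⊕ segℚ 0ᵠ R ≐ triℚ 0ᵠ (emb p) (emb q) ⊕ triℚ 0ᵠ (emb p) R)
        (sym (emb-sub p q)) (segℚ⊕segℚ⊕segℚ≐triℚ⊕triℚ (emb p) (emb q))

det2-o : ∀ p w → det2 o p w ≡ det p w
det2-o (a , b) (c , d) = lemma a b c d
  where
  lemma : ∀ a b c d → (a - + 0) * (d - + 0) - (b - + 0) * (c - + 0) ≡ a * d - b * c
  lemma = ℤ-Solver.solve-∀

len²-o : ∀ w → len² o w ≡ dot w w
len²-o (a , b) = lemma a b
  where
  lemma : ∀ a b → (a - + 0) * (a - + 0) + (b - + 0) * (b - + 0) ≡ a * a + b * b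
  lemma = ℤ-Solver.solve-∀

dot-self : ∀ w → dot w w ≡ + ‖ w ‖²
dot-self (a , b) = trans (cong₂ _+_ (square a) (square b)) (sym (ℤP.pos-+ (∣ a ∣ ℕ.* ∣ a ∣) _))
  where
  square : ∀ x → x * x ≡ + (∣ x ∣ ℕ.* ∣ x ∣)
  square (+ n) = sym (ℤP.pos-* n n)
  square -[1+ n ] = refl

det-o : ∀ p → det p o ≡ + 0
det-o (a , b) = lemma a b
  where
  lemma : ∀ a b → a * + 0 - b * + 0 ≡ + 0
  lemma = ℤ-Solver.solve-∀

det-sub-multiple : ∀ p q k → det p (q -ᵖ k • p) ≡ det p q
det-sub-multiple (a , b) (c , d) k = lemma a b c d k
  where
  lemma : ∀ a b c d k → a * (d - k * b) - b * (c - k * a) ≡ a * d - b * c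
  lemma = ℤ-Solver.solve-∀

dot-sub-multiple : ∀ p q k → dot p (q -ᵖ k • p) ≡ dot p q - k * dot p p
dot-sub-multiple (a , b) (c , d) k = lemma a b c d k
  where
  lemma : ∀ a b c d k → a * (c - k * a) + b * (d - k * b) ≡ a * c + b * d - k * (a * a + b * b)
  lemma = ℤ-Solver.solve-∀

det-complement : ∀ p q → det p (p -ᵖ q) ≡ - det p q
det-complement (a , b) (c , d) = lemma a b c d
  where
  lemma : ∀ a b c d → a * (b - d) - b * (a - c) ≡ - (a * d - b * c)
  lemma = ℤ-Solver.solve-∀

dot-complement : ∀ p q → dot p (p -ᵖ q) ≡ dot p p - dot p q
dot-complement (a , b) (c , d) = lemma a b c d
  where
  lemma : ∀ a b c d → a * (a - c) + b * (b - d) ≡ a * a + b * b - (a * c + b * d)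
  lemma = ℤ-Solver.solve-∀

det-bezout : ∀ a b σ τ x y → det (a , b) (τ * y , σ * x) ≡ x * (σ * a) - y * (τ * b)
det-bezout a b σ τ x y = lemma a b σ τ x y
  where
  lemma : ∀ a b σ τ x y → a * (σ * x) - b * (τ * y) ≡ x * (σ * a) - y * (τ * b)
  lemma = ℤ-Solver.solve-∀

lagrange : ∀ p w → dot w w * dot p p ≡ dot p w * dot p w + det p w * det p w
lagrange (a , b) (c , d) = lemma a b c d
  where
  lemma : ∀ a b c d →
    (c * c + d * d) * (a * a + b * b) ≡ (a * c + b * d) * (a * c + b * d) + (a * d - b * c) * (a * d - b * c)
  lemma = ℤ-Solver.solve-∀

∣i∣≡1⇒i*i≡1 : ∀ i → ∣ i ∣ ≡ 1 → i * i ≡ + 1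
∣i∣≡1⇒i*i≡1 (+ _) refl = refl
∣i∣≡1⇒i*i≡1 -[1+ _ ] refl = refl

1•w≡w : ∀ w → + 1 • w ≡ w
1•w≡w (a , b) = cong₂ _,_ (ℤP.*-identityˡ a) (ℤP.*-identityˡ b)

minTri⇒∣det∣≡1 : ∀ p w → MinTri o p w → ∣ det p w ∣ ≡ 1
minTri⇒∣det∣≡1 p w = subst (λ d → ∣ d ∣ ≡ 1) (det2-o p w)

∣det∣≡1⇒minTri : ∀ p w → ∣ det p w ∣ ≡ 1 → MinTri o p w
∣det∣≡1⇒minTri p w = subst (λ d → ∣ d ∣ ≡ 1) (sym (det2-o p w))

minTri⇒primeSeg : ∀ p w → MinTri o p w → PrimeSeg o w
minTri⇒primeSeg p w minTri = o≢w , endpoints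
  where
  d = det p w
  ∣d∣≡1 : ∣ d ∣ ≡ 1
  ∣d∣≡1 = minTri⇒∣det∣≡1 p w minTri
  o≢w : ¬ (o ≡ w)
  o≢w refl with trans (sym (cong ∣_∣ (det-o p))) ∣d∣≡1
  ... | ()
  -- d is a unit, so d · det p z = t for z = t w: an integer in [0 , 1]
  integral : ∀ {z s t} → emb z ≡ (s · 0ᵠ) +ᵠ (t · emb w) → embℤ (d * det p z) ≡ t
  integral {z} {s} {t} z≡tw = begin
    embℤ (d * det p z)                              ≡⟨ embℤ-* d (det p z) ⟩
    embℤ d ℚ.* embℤ (det p z)                        ≡⟨ cong (embℤ d ℚ.*_) (emb-det p z) ⟩
    embℤ d ℚ.* detℚ (emb p) (emb z)                  ≡⟨ cong (λ Z → embℤ d ℚ.* detℚ (emb p) Z) z≡tw ⟩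
    embℤ d ℚ.* detℚ (emb p) ((s · 0ᵠ) +ᵠ (t · emb w)) ≡⟨ cong (embℤ d ℚ.*_) (detℚ-scale (emb p) s t (emb w)) ⟩
    embℤ d ℚ.* (t ℚ.* detℚ (emb p) (emb w))          ≡⟨ cong (λ e → embℤ d ℚ.* (t ℚ.* e)) (emb-det p w) ⟨
    embℤ d ℚ.* (t ℚ.* embℤ d)                        ≡⟨ swap (embℤ d) t ⟩
    t ℚ.* (embℤ d ℚ.* embℤ d)                        ≡⟨ cong (t ℚ.*_) (embℤ-* d d) ⟨
    t ℚ.* embℤ (d * d)                               ≡⟨ cong (λ e → t ℚ.* embℤ e) (∣i∣≡1⇒i*i≡1 d ∣d∣≡1) ⟩
    t ℚ.* 1ℚ                                         ≡⟨ ℚP.*-identityʳ t ⟩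
    t                                                ∎
    where
    open ≡-Reasoning
    swap : ∀ x t → x ℚ.* (t ℚ.* x) ≡ t ℚ.* (x ℚ.* x)
    swap = solve-∀ ℚ-ring
  endpoints : ∀ z → seg o w (emb z) → z ≡ o ⊎ z ≡ w
  endpoints z (s , t , 0≤s , 0≤t , s+t≡1 , z≡tw) =
    Sum.map (λ t≡0 → on-ray {z} {w} {s} {t} {+ 0} z≡tw (sym t≡0))
            (λ t≡1 → trans (on-ray {z} {w} {s} {t} {+ 1} z≡tw (sym t≡1)) (1•w≡w w))
            (integral-0≤t≤1⇒t≡0∨1 (d * det p z) (integral {z} {s} {t} z≡tw) 0≤t (s+t≡1⇒t≤1 0≤s s+t≡1))

i≡[2+k]*i⇒i≡0 : ∀ k i → i ≡ + suc (suc k) * i → i ≡ + 0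
i≡[2+k]*i⇒i≡0 k (+ zero) _ = refl
i≡[2+k]*i⇒i≡0 k i@(+ suc _) eq with ℤP.*-cancelʳ-≡ (+ 1) (+ suc (suc k)) i (trans (ℤP.*-identityˡ i) eq)
... | ()
i≡[2+k]*i⇒i≡0 k i@(-[1+ _ ]) eq with ℤP.*-cancelʳ-≡ (+ 1) (+ suc (suc k)) i (trans (ℤP.*-identityˡ i) eq)
... | ()

¬primeSeg-o-multiple : ∀ k w → ¬ PrimeSeg o (+ suc (suc k) • w)
¬primeSeg-o-multiple k w@(a , b) (o≢gw , endpoints) = Sum.[ w≢o , w≢gw ] (endpoints w (∈seg-o-multiple (suc k) w))
  where
  w≢o : ¬ (w ≡ o)
  w≢o refl = o≢gw (cong₂ _,_ (sym (ℤP.*-zeroʳ (+ suc (suc k)))) (sym (ℤP.*-zeroʳ (+ suc (suc k)))))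
  w≢gw : ¬ (w ≡ + suc (suc k) • w)
  w≢gw eq = w≢o (cong₂ _,_ (i≡[2+k]*i⇒i≡0 k a (cong proj₁ eq)) (i≡[2+k]*i⇒i≡0 k b (cong proj₂ eq)))

primeSeg⇒coprime : ∀ {a b} → PrimeSeg o (a , b) → Coprime a b
primeSeg⇒coprime (o≢p , _) {zero} (0∣a , 0∣b) = ⊥-elim (o≢p (cong₂ _,_ (zero-of 0∣a) (zero-of 0∣b)))
  where
  zero-of : ∀ {i} → 0 ℕDiv.∣ ∣ i ∣ → + 0 ≡ i
  zero-of 0∣i = sym (ℤP.∣i∣≡0⇒i≡0 (ℕDiv.0∣⇒≡0 0∣i))
primeSeg⇒coprime _ {1} _ = refl
primeSeg⇒coprime {a} {b} prime {suc (suc k)} (g∣a , g∣b)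
  with ∣ᵤ⇒∣ {+ suc (suc k)} {a} g∣a | ∣ᵤ⇒∣ {+ suc (suc k)} {b} g∣b
... | divides a′ refl | divides b′ refl =
  ⊥-elim (¬primeSeg-o-multiple k (a′ , b′) (subst (PrimeSeg o) (cong₂ _,_ (ℤP.*-comm a′ _) (ℤP.*-comm b′ _)) prime))

sign-unit : ∀ i → Σ ℤ λ σ → σ * i ≡ + ∣ i ∣
sign-unit (+ n) = + 1 , ℤP.*-identityˡ (+ n)
sign-unit -[1+ n ] = - + 1 , ℤP.-1*i≡-i -[1+ n ]

1+yB≡xA⇒xA-yB≡1 : ∀ x A y B → 1 ℕ.+ y ℕ.* B ≡ x ℕ.* A → + x * + A - + y * + B ≡ + 1
1+yB≡xA⇒xA-yB≡1 x A y B eq = begin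
  + x * + A - + y * + B            ≡⟨ cong₂ _-_ (ℤP.pos-* x A) (ℤP.pos-* y B) ⟨
  + (x ℕ.* A) - + (y ℕ.* B)        ≡⟨ cong (λ n → + n - + (y ℕ.* B)) eq ⟨
  + (1 ℕ.+ y ℕ.* B) - + (y ℕ.* B)  ≡⟨ cong (_- + (y ℕ.* B)) (ℤP.pos-+ 1 (y ℕ.* B)) ⟩
  + 1 + + (y ℕ.* B) - + (y ℕ.* B)  ≡⟨ 1+n-n≡1 (+ (y ℕ.* B)) ⟩
  + 1                              ∎
  where
  open ≡-Reasoning
  1+n-n≡1 : ∀ n → + 1 + n - n ≡ + 1
  1+n-n≡1 = ℤ-Solver.solve-∀

coprime⇒det≡1 : ∀ {a b} → Coprime a b → Σ Pt λ q → det (a , b) q ≡ + 1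
coprime⇒det≡1 {a} {b} coprime with ℕCoprime.coprime-Bézout coprime | sign-unit a | sign-unit b
... | Bézout.+- x y eq | σ , σa≡∣a∣ | τ , τb≡∣b∣ = (τ * + y , σ * + x) , (begin
  det (a , b) (τ * + y , σ * + x)   ≡⟨ det-bezout a b σ τ (+ x) (+ y) ⟩
  + x * (σ * a) - + y * (τ * b)     ≡⟨ cong₂ (λ A B → + x * A - + y * B) σa≡∣a∣ τb≡∣b∣ ⟩
  + x * (+ ∣ a ∣) - + y * (+ ∣ b ∣) ≡⟨ 1+yB≡xA⇒xA-yB≡1 x (∣ a ∣) y (∣ b ∣) eq ⟩
  + 1                               ∎)
  where open ≡-Reasoning
... | Bézout.-+ x y eq | σ , σa≡∣a∣ | τ , τb≡∣b∣ = (τ * - + y , σ * - + x) , (begin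
  det (a , b) (τ * - + y , σ * - + x)   ≡⟨ det-bezout a b σ τ (- + x) (- + y) ⟩
  - + x * (σ * a) - - + y * (τ * b)     ≡⟨ cong₂ (λ A B → - + x * A - - + y * B) σa≡∣a∣ τb≡∣b∣ ⟩
  - + x * (+ ∣ a ∣) - - + y * (+ ∣ b ∣) ≡⟨ swap (+ x) (+ ∣ a ∣) (+ y) (+ ∣ b ∣) ⟩
  + y * (+ ∣ b ∣) - + x * (+ ∣ a ∣)     ≡⟨ 1+yB≡xA⇒xA-yB≡1 y (∣ b ∣) x (∣ a ∣) eq ⟩
  + 1                                   ∎)
  where
  open ≡-Reasoning
  swap : ∀ x A y B → - x * A - - y * B ≡ y * B - x * A
  swap = ℤ-Solver.solve-∀

o≢p⇒0<‖p‖² : ∀ {p} → ¬ (o ≡ p) → 0 ℕ.< ‖ p ‖²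
o≢p⇒0<‖p‖² {+ suc _ , _} _ = s≤s z≤n
o≢p⇒0<‖p‖² { -[1+ _ ] , _} _ = s≤s z≤n
o≢p⇒0<‖p‖² {+ 0 , + suc _} _ = s≤s z≤n
o≢p⇒0<‖p‖² {+ 0 , -[1+ _ ]} _ = s≤s z≤n
o≢p⇒0<‖p‖² {+ 0 , + 0} o≢p = ⊥-elim (o≢p refl)

record ReducedCompletion (p : Pt) : Set where
  field
    q : Pt
    r : ℕ
    det≡1 : det p q ≡ + 1
    dot≡r : dot p q ≡ + r
    r<‖p‖² : r ℕ.< ‖ p ‖²

primeSeg⇒reducedCompletion : ∀ p → PrimeSeg o p → ReducedCompletion p
primeSeg⇒reducedCompletion p@(a , b) prime@(o≢p , _) with coprime⇒det≡1 {a} {b} (primeSeg⇒coprime {a} {b} prime)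
... | q₀ , det≡1 = record
  { q = q₀ -ᵖ k • p
  ; r = r
  ; det≡1 = trans (det-sub-multiple p q₀ k) det≡1
  ; dot≡r = dot≡r
  ; r<‖p‖² = n%ℕd<d (dot p q₀) n
  }
  where
  n = ‖ p ‖²
  instance
    _ : ℕ.NonZero n
    _ = ℕ.>-nonZero (o≢p⇒0<‖p‖² o≢p)
  k = dot p q₀ ℤ./ℕ n
  r = dot p q₀ ℤ.%ℕ n
  dot≡r : dot p (q₀ -ᵖ k • p) ≡ + r
  dot≡r = begin
    dot p (q₀ -ᵖ k • p)      ≡⟨ dot-sub-multiple p q₀ k ⟩
    dot p q₀ - k * dot p p   ≡⟨ cong₂ (λ x y → x - k * y) (a≡a%ℕn+[a/ℕn]*n (dot p q₀) n) (dot-self p) ⟩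
    + r + k * + n - k * + n  ≡⟨ m+n-n≡m (+ r) (k * + n) ⟩
    + r                      ∎
    where
    open ≡-Reasoning
    m+n-n≡m : ∀ m n → m + n - n ≡ m
    m+n-n≡m = ℤ-Solver.solve-∀

L*n≡m*m+1⇒L<n : ∀ {L n m} → L ℕ.* n ≡ m ℕ.* m ℕ.+ 1 → 0 ℕ.< m → m ℕ.< n → L ℕ.< n
L*n≡m*m+1⇒L<n {L} {n} {m} eq 0<m m<n = ℕP.≰⇒> λ n≤L → ℕP.<⇒≱ m*m+1<[1+m]² (begin
  suc m ℕ.* suc m  ≤⟨ ℕP.*-mono-≤ m<n m<n ⟩
  n ℕ.* n          ≤⟨ ℕP.*-monoˡ-≤ n n≤L ⟩
  L ℕ.* n          ≡⟨ eq ⟩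
  m ℕ.* m ℕ.+ 1    ∎)
  where
  open ℕP.≤-Reasoning
  expand : ∀ m → suc m ℕ.* suc m ≡ m ℕ.* m ℕ.+ 1 ℕ.+ (m ℕ.+ m)
  expand = ℕ-Solver.solve-∀
  m*m+1<[1+m]² : m ℕ.* m ℕ.+ 1 ℕ.< suc m ℕ.* suc m
  m*m+1<[1+m]² = begin-strict
    m ℕ.* m ℕ.+ 1                ≡⟨ ℕP.+-identityʳ _ ⟨
    m ℕ.* m ℕ.+ 1 ℕ.+ 0          <⟨ ℕP.+-monoʳ-< (m ℕ.* m ℕ.+ 1) (ℕP.<-≤-trans 0<m (ℕP.m≤m+n m m)) ⟩
    m ℕ.* m ℕ.+ 1 ℕ.+ (m ℕ.+ m)  ≡⟨ expand m ⟨
    suc m ℕ.* suc m              ∎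

lagrangeℕ : ∀ p w {m} → ∣ det p w ∣ ≡ 1 → dot p w ≡ + m → ‖ w ‖² ℕ.* ‖ p ‖² ≡ m ℕ.* m ℕ.+ 1
lagrangeℕ p w {m} ∣det∣≡1 dot≡m = ℤP.+-injective (begin
  + (‖ w ‖² ℕ.* ‖ p ‖²)                   ≡⟨ ℤP.pos-* ‖ w ‖² ‖ p ‖² ⟩
  + ‖ w ‖² * + ‖ p ‖²                     ≡⟨ cong₂ _*_ (dot-self w) (dot-self p) ⟨
  dot w w * dot p p                       ≡⟨ lagrange p w ⟩
  dot p w * dot p w + det p w * det p w   ≡⟨ cong₂ (λ x y → x * x + y) dot≡m (∣i∣≡1⇒i*i≡1 (det p w) ∣det∣≡1) ⟩
  + m * + m + + 1                         ≡⟨ cong (λ x → x + + 1) (ℤP.pos-* m m) ⟨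
  + (m ℕ.* m) + + 1                       ≡⟨ ℤP.pos-+ (m ℕ.* m) 1 ⟨
  + (m ℕ.* m ℕ.+ 1)                       ∎)
  where open ≡-Reasoning

minTri⇒len²< : ∀ p w {m} → MinTri o p w → dot p w ≡ + m → 0 ℕ.< m → m ℕ.< ‖ p ‖² → len² o w < len² o p
minTri⇒len²< p w minTri dot≡m 0<m m<n =
  subst₂ _<_ (sym (len²≡‖‖² w)) (sym (len²≡‖‖² p))
         (ℤ.+<+ (L*n≡m*m+1⇒L<n (lagrangeℕ p w (minTri⇒∣det∣≡1 p w minTri) dot≡m) 0<m m<n))
  where
  len²≡‖‖² : ∀ v → len² o v ≡ + ‖ v ‖²
  len²≡‖‖² v = trans (len²-o v) (dot-self v)

2≤‖p‖² : ∀ p → ¬ (o ≡ p) →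
  ¬ (p ≡ (+ 1 , + 0)) → ¬ (p ≡ (-[1+ 0 ] , + 0)) → ¬ (p ≡ (+ 0 , + 1)) → ¬ (p ≡ (+ 0 , -[1+ 0 ])) →
  2 ℕ.≤ ‖ p ‖²
2≤‖p‖² (+ suc (suc _) , _) _ _ _ _ _ = s≤s (s≤s z≤n)
2≤‖p‖² (-[1+ suc _ ] , _) _ _ _ _ _ = s≤s (s≤s z≤n)
2≤‖p‖² (a , + suc (suc _)) _ _ _ _ _ = ℕP.≤-trans (s≤s (s≤s z≤n)) (ℕP.m≤n+m _ (∣ a ∣ ℕ.* ∣ a ∣))
2≤‖p‖² (a , -[1+ suc _ ]) _ _ _ _ _ = ℕP.≤-trans (s≤s (s≤s z≤n)) (ℕP.m≤n+m _ (∣ a ∣ ℕ.* ∣ a ∣))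
2≤‖p‖² (+ 0 , + 0) o≢p _ _ _ _ = ⊥-elim (o≢p refl)
2≤‖p‖² (+ 1 , + 0) _ ≢e₁ _ _ _ = ⊥-elim (≢e₁ refl)
2≤‖p‖² (-[1+ 0 ] , + 0) _ _ ≢-e₁ _ _ = ⊥-elim (≢-e₁ refl)
2≤‖p‖² (+ 0 , + 1) _ _ _ ≢e₂ _ = ⊥-elim (≢e₂ refl)
2≤‖p‖² (+ 0 , -[1+ 0 ]) _ _ _ _ ≢-e₂ = ⊥-elim (≢-e₂ refl)
2≤‖p‖² (+ 1 , + 1) _ _ _ _ _ = s≤s (s≤s z≤n)
2≤‖p‖² (+ 1 , -[1+ 0 ]) _ _ _ _ _ = s≤s (s≤s z≤n)
2≤‖p‖² (-[1+ 0 ] , + 1) _ _ _ _ _ = s≤s (s≤s z≤n)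
2≤‖p‖² (-[1+ 0 ] , -[1+ 0 ]) _ _ _ _ _ = s≤s (s≤s z≤n)

corollary3 : (a b : ℤ) →
    PrimeSeg o (a , b) →
    ¬ ((a , b) ≡ (+ 1 , + 0)) → ¬ ((a , b) ≡ (-[1+ 0 ] , + 0)) →
    ¬ ((a , b) ≡ (+ 0 , + 1)) → ¬ ((a , b) ≡ (+ 0 , -[1+ 0 ])) →
    Σ Pt λ q →
      MinTri o (a , b) q × MinTri o (a , b) ((a , b) -ᵖ q) ×
      PrimeSeg o q × PrimeSeg o ((a , b) -ᵖ q) ×
      len² o q < len² o (a , b) × len² o ((a , b) -ᵖ q) < len² o (a , b) ×
      (seg o (a , b) ⊕ seg o q ⊕ seg o ((a , b) -ᵖ q)
        ≐ tri o (a , b) q ⊕ tri o (a , b) ((a , b) -ᵖ q))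
corollary3 a b prime ≢e₁ ≢-e₁ ≢e₂ ≢-e₂ =
  q , minTri-q , minTri-p-q , minTri⇒primeSeg p q minTri-q , minTri⇒primeSeg p (p -ᵖ q) minTri-p-q ,
  minTri⇒len²< p q minTri-q dot≡r 0<r r<‖p‖² ,
  minTri⇒len²< p (p -ᵖ q) minTri-p-q dot≡n-r (ℕP.m<n⇒0<n∸m r<‖p‖²) (ℕP.∸-monoʳ-< 0<r (ℕP.<⇒≤ r<‖p‖²)) ,
  seg⊕seg⊕seg≐tri⊕tri p q
  where
  p = (a , b)
  n = ‖ p ‖²
  open ReducedCompletion (primeSeg⇒reducedCompletion p prime)
  minTri-q : MinTri o p q
  minTri-q = ∣det∣≡1⇒minTri p q (cong ∣_∣ det≡1)
  minTri-p-q : MinTri o p (p -ᵖ q)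
  minTri-p-q = ∣det∣≡1⇒minTri p (p -ᵖ q) (cong ∣_∣ (trans (det-complement p q) (cong -_ det≡1)))
  dot≡n-r : dot p (p -ᵖ q) ≡ + (n ℕ.∸ r)
  dot≡n-r = trans (dot-complement p q) (trans (cong₂ _-_ (dot-self p) dot≡r)
                  (trans (ℤP.m-n≡m⊖n n r) (ℤP.⊖-≥ (ℕP.<⇒≤ r<‖p‖²))))
  0<r : 0 ℕ.< r
  0<r = ℕP.n≢0⇒n>0 λ r≡0 →
    ℕP.<⇒≱ (2≤‖p‖² p (proj₁ prime) ≢e₁ ≢-e₁ ≢e₂ ≢-e₂)
           (ℕP.≤-reflexive (ℕP.m*n≡1⇒n≡1 ‖ q ‖² n
             (lagrangeℕ p q (cong ∣_∣ det≡1) (subst (λ m → dot p q ≡ + m) r≡0 dot≡r))))
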